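{- Let $A$ be an $m$-by-$n$ $(0,1,\ast)$-matrix and $H$ a $(0,1)$-matrix with $n$ columns. Then $\ker H=\{\mathbf{x}:H\mathbf{x}=\mathbf{0}\}$ is a solution for $A$ if and only if there is a completion $M$ of $A$ every row of which is a rows of the span-matrix of $H$, i.e. every row of $M$ is a $GF_2$-linear combination of rows of $H$.
   Context: A $(0,1,\ast)$-matrix has entries in $\{0,1,\ast\}$; arithmetic is over $GF_2$. A completion of $A$ is obtained by replacing each $\ast$ by $0$ or $1$. An operator $G=(g_1,\dots,g_m):\{0,1\}^n\to\{0,1\}^m$ is consistent with $A=(a_{ij})$ if each $g_i$ depends only on variables $x_j$ with $a_{ij}=\ast$. A set $L\subseteq\{0,1\}^n$ is a solution for $A$ if there exist a completion $M$ and a consistent $G$ with $M\mathbf{x}=G(\mathbf{x})$ for all $\mathbf{x}\in L$. The span-matrix of $H$ is the matrix whose rows are all $GF_2$-linear combinations of the rows of $H$. -}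

module Defs where

open import Data.Nat using (ℕ; zero; suc)
open import Data.Fin using (Fin; zero; suc)
open import Data.Bool using (Bool; true; false; _xor_; _∧_)
open import Data.Product using (Σ; _×_; ∃)
open import Relation.Binary.PropositionalEquality using (_≡_)

-- GF(2) is represented by Bool: addition = xor, multiplication = ∧.

data Entry : Set where
  e0 e1 ∗ : Entry

PMatrix : ℕ → ℕ → Set
PMatrix m n = Fin m → Fin n → Entry

BMatrix : ℕ → ℕ → Set
BMatrix m n = Fin m → Fin n → Bool

BVec : ℕ → Set
BVec n = Fin n → Bool

Σ₂ : ∀ n → (Fin n → Bool) → Bool
Σ₂ zero    f = false
Σ₂ (suc n) f = f zero xor Σ₂ n (λ j → f (suc j))

_·_ : ∀ {m n} → BMatrix m n → BVec n → BVec m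
_·_ {n = n} M x i = Σ₂ n (λ j → M i j ∧ x j)

IsCompletion : ∀ {m n} → PMatrix m n → BMatrix m n → Set
IsCompletion A M = ∀ i j → (A i j ≡ e0 → M i j ≡ false) × (A i j ≡ e1 → M i j ≡ true)

Operator : ℕ → ℕ → Set
Operator m n = BVec n → BVec m

Consistent : ∀ {m n} → PMatrix m n → Operator m n → Set
Consistent {m} {n} A G =
  ∀ (i : Fin m) (x y : BVec n) →
    (∀ j → A i j ≡ ∗ → x j ≡ y j) → G x i ≡ G y i

IsSolution : ∀ {m n} → PMatrix m n → (BVec n → Set) → Set
IsSolution {m} {n} A L =
  Σ (BMatrix m n) λ M → Σ (Operator m n) λ G →
    IsCompletion A M × Consistent A G × (∀ x → L x → ∀ i → (M · x) i ≡ G x i)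

Ker : ∀ {k n} → BMatrix k n → BVec n → Set
Ker {k} H x = ∀ (l : Fin k) → (H · x) l ≡ false

InRowSpan : ∀ {k n} → BMatrix k n → BVec n → Set
InRowSpan {k} {n} H r =
  Σ (BVec k) λ c → ∀ (j : Fin n) → r j ≡ Σ₂ k (λ l → c l ∧ H l j)

-- If every row of M lies in the row space of H, then M kills ker H and G = 0 works.
-- Conversely, fix a row i of a solution (M , G) and let F be its non-∗ positions. Every
-- x ∈ ker H vanishing off F satisfies M i · x = G x i = G 0 i = M i · 0 = 0, so M i
-- restricted to F annihilates the kernel of H restricted to F. Over a field that
-- annihilator is the row space (proved by Gaussian elimination on the first column), so
-- M i agrees on F with some combination of rows of H; these combinations form the
-- required completion.
module Submission where

open import Defs
open import Data.Nat using (zero; suc)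
open import Data.Fin using (Fin; zero; suc)
open import Data.Fin.Properties using (any?)
open import Data.Bool using (Bool; true; false; _xor_; _∧_; _≟_)
open import Data.Bool.Properties
  using (xor-assoc; xor-comm; xor-same; xor-identityʳ; ∧-assoc; ∧-comm; ∧-zeroʳ; ∧-identityʳ;
         ∧-distribˡ-xor; ∧-distribʳ-xor; xor-∧-commutativeRing; ¬-not)
open import Data.Vec.Functional using (_∷_; tail)
open import Data.Product using (Σ; _×_; _,_; proj₁; proj₂)
open import Algebra.Bundles using (CommutativeRing)
open import Algebra.Properties.CommutativeSemigroup
  (CommutativeRing.+-commutativeSemigroup xor-∧-commutativeRing) using (interchange)
open import Function.Bundles using (_⇔_; mk⇔)
open import Relation.Nullary using (yes; no)
open import Relation.Binary.PropositionalEquality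
open ≡-Reasoning

xor-cancelˡ : ∀ a b → a xor (a xor b) ≡ b
xor-cancelˡ a b = trans (sym (xor-assoc a a b)) (cong (_xor b) (xor-same a))

xor-cancelʳ : ∀ a b → (a xor b) xor b ≡ a
xor-cancelʳ a b = trans (xor-assoc a b b) (trans (cong (a xor_) (xor-same b)) (xor-identityʳ a))

Σ₂-cong : ∀ n {f g : Fin n → Bool} → (∀ j → f j ≡ g j) → Σ₂ n f ≡ Σ₂ n g
Σ₂-cong zero    f≡g = refl
Σ₂-cong (suc n) f≡g = cong₂ _xor_ (f≡g zero) (Σ₂-cong n (λ j → f≡g (suc j)))

Σ₂-false : ∀ n {f : Fin n → Bool} → (∀ j → f j ≡ false) → Σ₂ n f ≡ false
Σ₂-false zero    f≡false = refl
Σ₂-false (suc n) f≡false =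
  cong₂ _xor_ (f≡false zero) (Σ₂-false n (λ j → f≡false (suc j)))

Σ₂-xor : ∀ n (f g : Fin n → Bool) → Σ₂ n (λ j → f j xor g j) ≡ Σ₂ n f xor Σ₂ n g
Σ₂-xor zero    f g = refl
Σ₂-xor (suc n) f g = trans
  (cong ((f zero xor g zero) xor_) (Σ₂-xor n (λ j → f (suc j)) (λ j → g (suc j))))
  (interchange (f zero) (g zero) _ _)

Σ₂-∧ˡ : ∀ n a (f : Fin n → Bool) → Σ₂ n (λ j → a ∧ f j) ≡ a ∧ Σ₂ n f
Σ₂-∧ˡ zero    a f = sym (∧-zeroʳ a)
Σ₂-∧ˡ (suc n) a f = trans
  (cong ((a ∧ f zero) xor_) (Σ₂-∧ˡ n a (λ j → f (suc j))))
  (sym (∧-distribˡ-xor a (f zero) _))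

Σ₂-∧ʳ : ∀ n a (f : Fin n → Bool) → Σ₂ n (λ j → f j ∧ a) ≡ Σ₂ n f ∧ a
Σ₂-∧ʳ n a f = begin
  Σ₂ n (λ j → f j ∧ a)  ≡⟨ Σ₂-cong n (λ j → ∧-comm (f j) a) ⟩
  Σ₂ n (λ j → a ∧ f j)  ≡⟨ Σ₂-∧ˡ n a f ⟩
  a ∧ Σ₂ n f            ≡⟨ ∧-comm a _ ⟩
  Σ₂ n f ∧ a            ∎

Σ₂-swap : ∀ m n (f : Fin m → Fin n → Bool) →
  Σ₂ m (λ i → Σ₂ n (f i)) ≡ Σ₂ n (λ j → Σ₂ m (λ i → f i j))
Σ₂-swap zero    n f = sym (Σ₂-false n (λ _ → refl))
Σ₂-swap (suc m) n f = trans
  (cong (Σ₂ n (f zero) xor_) (Σ₂-swap m n (λ i → f (suc i))))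
  (sym (Σ₂-xor n (f zero) (λ j → Σ₂ m (λ i → f (suc i) j))))

unit : ∀ {k} → Fin k → BVec k
unit zero    zero    = true
unit zero    (suc _) = false
unit (suc _) zero    = false
unit (suc p) (suc l) = unit p l

Σ₂-unit : ∀ k (p : Fin k) (f : Fin k → Bool) → Σ₂ k (λ l → unit p l ∧ f l) ≡ f p
Σ₂-unit (suc k) zero    f = trans (cong (f zero xor_) (Σ₂-false k (λ _ → refl))) (xor-identityʳ _)
Σ₂-unit (suc k) (suc p) f = Σ₂-unit k p (λ l → f (suc l))

zeros : ∀ {n} → BVec n
zeros _ = false

_∙_ : ∀ {n} → BVec n → BVec n → Bool
_∙_ {n} u x = Σ₂ n (λ j → u j ∧ x j)

∙-zeroʳ : ∀ {n} (u : BVec n) {x : BVec n} → (∀ j → x j ≡ false) → u ∙ x ≡ false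
∙-zeroʳ {n} u x≡0 = Σ₂-false n (λ j → trans (cong (u j ∧_) (x≡0 j)) (∧-zeroʳ (u j)))

∙-first : ∀ {n} (u : BVec (suc n)) → u ∙ (true ∷ zeros) ≡ u zero
∙-first u = trans (cong₂ _xor_ (∧-identityʳ (u zero)) (∙-zeroʳ (tail u) (λ _ → refl))) (xor-identityʳ _)

combination : ∀ {k n} → BVec k → BMatrix k n → BVec n
combination {k} c K j = Σ₂ k (λ l → c l ∧ K l j)

combination-∙ : ∀ {k n} (c : BVec k) (K : BMatrix k n) (x : BVec n) →
  combination c K ∙ x ≡ c ∙ (K · x)
combination-∙ {k} {n} c K x = begin
  Σ₂ n (λ j → Σ₂ k (λ l → c l ∧ K l j) ∧ x j)    ≡⟨ Σ₂-cong n (λ j → sym (Σ₂-∧ʳ k (x j) _)) ⟩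
  Σ₂ n (λ j → Σ₂ k (λ l → (c l ∧ K l j) ∧ x j))  ≡⟨ sym (Σ₂-swap k n _) ⟩
  Σ₂ k (λ l → Σ₂ n (λ j → (c l ∧ K l j) ∧ x j))  ≡⟨ Σ₂-cong k (λ l → Σ₂-cong n (λ j → ∧-assoc (c l) _ _)) ⟩
  Σ₂ k (λ l → Σ₂ n (λ j → c l ∧ (K l j ∧ x j)))  ≡⟨ Σ₂-cong k (λ l → Σ₂-∧ˡ n (c l) _) ⟩
  c ∙ (K · x)                                     ∎

combination-xor-unit : ∀ {k n} (c : BVec k) (α : Bool) (p : Fin k) (K : BMatrix k n) j →
  combination (λ l → c l xor (α ∧ unit p l)) K j ≡ combination c K j xor (α ∧ K p j)
combination-xor-unit {k} c α p K j = begin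
  Σ₂ k (λ l → (c l xor (α ∧ unit p l)) ∧ K l j)
    ≡⟨ Σ₂-cong k (λ l → ∧-distribʳ-xor (K l j) (c l) _) ⟩
  Σ₂ k (λ l → (c l ∧ K l j) xor ((α ∧ unit p l) ∧ K l j))
    ≡⟨ Σ₂-xor k _ _ ⟩
  combination c K j xor Σ₂ k (λ l → (α ∧ unit p l) ∧ K l j)
    ≡⟨ cong (combination c K j xor_) (Σ₂-cong k (λ l → ∧-assoc α (unit p l) (K l j))) ⟩
  combination c K j xor Σ₂ k (λ l → α ∧ (unit p l ∧ K l j))
    ≡⟨ cong (combination c K j xor_) (trans (Σ₂-∧ˡ k α _) (cong (α ∧_) (Σ₂-unit k p (λ l → K l j)))) ⟩
  combination c K j xor (α ∧ K p j)
    ∎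

_⊥ker_ : ∀ {k n} → BVec n → BMatrix k n → Set
r ⊥ker K = ∀ x → Ker K x → r ∙ x ≡ false

tail-⊥ker : ∀ {k n} (K : BMatrix k (suc n)) (r : BVec (suc n)) →
  r ⊥ker K → tail r ⊥ker (λ l → tail (K l))
tail-⊥ker K r r⊥K x x∈ker = trans
  (sym (cong (_xor (tail r ∙ x)) (∧-zeroʳ (r zero))))
  (r⊥K (false ∷ x) (λ l → cong₂ _xor_ (∧-zeroʳ (K l zero)) (x∈ker l)))

-- Row reduction against a pivot row whose tail is q: u ↦ tail u + head u · q.
reduceBy : ∀ {n} → BVec n → BVec (suc n) → BVec n
reduceBy q u j = tail u j xor (u zero ∧ q j)

reduceBy-∙ : ∀ {n} (q : BVec n) (u : BVec (suc n)) (x : BVec n) →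
  reduceBy q u ∙ x ≡ u ∙ ((q ∙ x) ∷ x)
reduceBy-∙ {n} q u x = begin
  Σ₂ n (λ j → (tail u j xor (u zero ∧ q j)) ∧ x j)
    ≡⟨ Σ₂-cong n (λ j → ∧-distribʳ-xor (x j) (tail u j) _) ⟩
  Σ₂ n (λ j → (tail u j ∧ x j) xor ((u zero ∧ q j) ∧ x j))
    ≡⟨ Σ₂-xor n _ _ ⟩
  tail u ∙ x xor Σ₂ n (λ j → (u zero ∧ q j) ∧ x j)
    ≡⟨ cong (tail u ∙ x xor_) (Σ₂-cong n (λ j → ∧-assoc (u zero) (q j) (x j))) ⟩
  tail u ∙ x xor Σ₂ n (λ j → u zero ∧ (q j ∧ x j))
    ≡⟨ cong (tail u ∙ x xor_) (Σ₂-∧ˡ n (u zero) _) ⟩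
  tail u ∙ x xor (u zero ∧ q ∙ x)
    ≡⟨ xor-comm (tail u ∙ x) _ ⟩
  u ∙ ((q ∙ x) ∷ x)
    ∎

reduceBy-⊥ker : ∀ {k n} (q : BVec n) (K : BMatrix k (suc n)) (r : BVec (suc n)) →
  r ⊥ker K → reduceBy q r ⊥ker (λ l → reduceBy q (K l))
reduceBy-⊥ker q K r r⊥K x x∈ker = trans (reduceBy-∙ q r x)
  (r⊥K ((q ∙ x) ∷ x) (λ l → trans (sym (reduceBy-∙ q (K l) x)) (x∈ker l)))

combination-reduceBy : ∀ {k n} (c : BVec k) (q : BVec n) (K : BMatrix k (suc n)) j →
  combination c (λ l → reduceBy q (K l)) j ≡ combination c K (suc j) xor (combination c K zero ∧ q j)
combination-reduceBy {k} c q K j = begin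
  Σ₂ k (λ l → c l ∧ (K l (suc j) xor (K l zero ∧ q j)))
    ≡⟨ Σ₂-cong k (λ l → ∧-distribˡ-xor (c l) _ _) ⟩
  Σ₂ k (λ l → (c l ∧ K l (suc j)) xor (c l ∧ (K l zero ∧ q j)))
    ≡⟨ Σ₂-xor k _ _ ⟩
  combination c K (suc j) xor Σ₂ k (λ l → c l ∧ (K l zero ∧ q j))
    ≡⟨ cong (combination c K (suc j) xor_) (Σ₂-cong k (λ l → sym (∧-assoc (c l) _ _))) ⟩
  combination c K (suc j) xor Σ₂ k (λ l → (c l ∧ K l zero) ∧ q j)
    ≡⟨ cong (combination c K (suc j) xor_) (Σ₂-∧ʳ k (q j) _) ⟩
  combination c K (suc j) xor (combination c K zero ∧ q j)
    ∎

-- Adding the right multiple of the pivot row to a combination repairs the first column.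
InRowSpan-unreduce : ∀ {k n} (K : BMatrix k (suc n)) (r : BVec (suc n)) (p : Fin k) →
  K p zero ≡ true →
  InRowSpan (λ l → reduceBy (tail (K p)) (K l)) (reduceBy (tail (K p)) r) → InRowSpan K r
InRowSpan-unreduce K r p pivot (c , r′≡) = c′ , λ { zero → column₀ ; (suc j) → column₊ j }
  where
  β α : Bool
  β = combination c K zero
  α = β xor r zero

  c′ : BVec _
  c′ l = c l xor (α ∧ unit p l)

  column₀ : r zero ≡ combination c′ K zero
  column₀ = sym (begin
    combination c′ K zero     ≡⟨ combination-xor-unit c α p K zero ⟩
    β xor (α ∧ K p zero)      ≡⟨ cong (λ b → β xor (α ∧ b)) pivot ⟩
    β xor (α ∧ true)          ≡⟨ cong (β xor_) (∧-identityʳ α) ⟩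
    β xor (β xor r zero)      ≡⟨ xor-cancelˡ β (r zero) ⟩
    r zero                    ∎)

  column₊ : ∀ j → r (suc j) ≡ combination c′ K (suc j)
  column₊ j = let q = K p (suc j) ; γ = combination c K (suc j) in begin
    r (suc j)                                ≡⟨ sym (xor-cancelʳ (r (suc j)) (r zero ∧ q)) ⟩
    (r (suc j) xor (r zero ∧ q)) xor (r zero ∧ q)
      ≡⟨ cong (_xor (r zero ∧ q)) (trans (r′≡ j) (combination-reduceBy c (tail (K p)) K j)) ⟩
    (γ xor (β ∧ q)) xor (r zero ∧ q)         ≡⟨ xor-assoc γ _ _ ⟩
    γ xor ((β ∧ q) xor (r zero ∧ q))         ≡⟨ cong (γ xor_) (sym (∧-distribʳ-xor q β (r zero))) ⟩
    γ xor (α ∧ q)                            ≡⟨ sym (combination-xor-unit c α p K (suc j)) ⟩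
    combination c′ K (suc j)                 ∎

⊥ker⇒InRowSpan : ∀ {k} n (K : BMatrix k n) (r : BVec n) → r ⊥ker K → InRowSpan K r
⊥ker⇒InRowSpan zero    K r r⊥K = zeros , λ ()
⊥ker⇒InRowSpan {k} (suc n) K r r⊥K with any? (λ l → K l zero ≟ true)
... | yes (p , pivot) = InRowSpan-unreduce K r p pivot
        (⊥ker⇒InRowSpan n _ _ (reduceBy-⊥ker (tail (K p)) K r r⊥K))
... | no noPivot = c , λ { zero → column₀ ; (suc j) → tail-r≡ j }
  where
  column₀-false : ∀ l → K l zero ≡ false
  column₀-false l = ¬-not (λ e → noPivot (l , e))

  r₀-false : r zero ≡ false
  r₀-false = trans (sym (∙-first r))
    (r⊥K (true ∷ zeros) (λ l → trans (∙-first (K l)) (column₀-false l)))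

  IH : InRowSpan (λ l → tail (K l)) (tail r)
  IH = ⊥ker⇒InRowSpan n _ _ (tail-⊥ker K r r⊥K)
  c : BVec k
  c = proj₁ IH

  tail-r≡ : ∀ j → r (suc j) ≡ combination c (λ l → tail (K l)) j
  tail-r≡ = proj₂ IH

  column₀ : r zero ≡ combination c K zero
  column₀ = trans r₀-false (sym (∙-zeroʳ c column₀-false))

InRowSpan-on : ∀ {k n} → BMatrix k n → BVec n → BVec n → Set
InRowSpan-on {k} K t r = Σ (BVec k) λ c → ∀ j → t j ≡ true → r j ≡ combination c K j

-- Duality relative to a set t of coordinates, obtained from the absolute version by
-- zeroing the columns outside t.
⊥ker-on⇒InRowSpan-on : ∀ {k n} (K : BMatrix k n) (t r : BVec n) →
  (∀ x → Ker K x → (∀ j → t j ≡ false → x j ≡ false) → r ∙ x ≡ false) → InRowSpan-on K t r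
⊥ker-on⇒InRowSpan-on {k} {n} K t r r⊥ = c , r≡
  where
  mask : BVec n → BVec n
  mask u j = u j ∧ t j

  mask-∙ : ∀ u x → mask u ∙ x ≡ u ∙ (λ j → t j ∧ x j)
  mask-∙ u x = Σ₂-cong n (λ j → ∧-assoc (u j) (t j) (x j))

  masked-⊥ker : mask r ⊥ker (λ l → mask (K l))
  masked-⊥ker x x∈ker = trans (mask-∙ r x)
    (r⊥ _ (λ l → trans (sym (mask-∙ (K l) x)) (x∈ker l)) (λ j tj≡false → cong (_∧ x j) tj≡false))

  IH : InRowSpan (λ l → mask (K l)) (mask r)
  IH = ⊥ker⇒InRowSpan n _ _ masked-⊥ker

  c : BVec k
  c = proj₁ IH

  r≡ : ∀ j → t j ≡ true → r j ≡ combination c K j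
  r≡ j tj≡true = begin
    r j                                  ≡⟨ sym (∧-identityʳ (r j)) ⟩
    r j ∧ true                           ≡⟨ cong (r j ∧_) (sym tj≡true) ⟩
    mask r j                             ≡⟨ proj₂ IH j ⟩
    Σ₂ k (λ l → c l ∧ (K l j ∧ t j))     ≡⟨ Σ₂-cong k (λ l → sym (∧-assoc (c l) (K l j) (t j))) ⟩
    Σ₂ k (λ l → (c l ∧ K l j) ∧ t j)     ≡⟨ Σ₂-∧ʳ k (t j) _ ⟩
    combination c K j ∧ t j              ≡⟨ cong (combination c K j ∧_) tj≡true ⟩
    combination c K j ∧ true             ≡⟨ ∧-identityʳ _ ⟩
    combination c K j                    ∎

isFixed : Entry → Bool
isFixed e0 = true
isFixed e1 = true
isFixed ∗  = false

RowSpanCompletion : ∀ {m n k} → PMatrix m n → BMatrix k n → Set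
RowSpanCompletion {m} {n} A H = Σ (BMatrix m n) (λ M → IsCompletion A M × (∀ i → InRowSpan H (M i)))

module _ {m n k} (A : PMatrix m n) (H : BMatrix k n) where

  zeros∈Ker : Ker H zeros
  zeros∈Ker l = ∙-zeroʳ (H l) (λ _ → refl)

  solution⇒rowSpanCompletion : IsSolution A (Ker H) → RowSpanCompletion A H
  solution⇒rowSpanCompletion (M , G , M-completes , G-consistent , M≡G) =
    M′ , M′-completes , λ i → proj₁ (agreement i) , λ _ → refl
    where
    agreement : ∀ i → InRowSpan-on H (λ j → isFixed (A i j)) (M i)
    agreement i = ⊥ker-on⇒InRowSpan-on H _ (M i) λ x x∈ker x-vanishes → begin
      M i ∙ x      ≡⟨ M≡G x x∈ker i ⟩
      G x i        ≡⟨ G-consistent i x zeros (λ j e → x-vanishes j (cong isFixed e)) ⟩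
      G zeros i    ≡⟨ sym (M≡G zeros zeros∈Ker i) ⟩
      M i ∙ zeros  ≡⟨ ∙-zeroʳ (M i) (λ _ → refl) ⟩
      false        ∎

    M′ : BMatrix m n
    M′ i = combination (proj₁ (agreement i)) H

    M′-completes : IsCompletion A M′
    M′-completes i j =
      (λ e → trans (sym (proj₂ (agreement i) j (cong isFixed e))) (proj₁ (M-completes i j) e)) ,
      (λ e → trans (sym (proj₂ (agreement i) j (cong isFixed e))) (proj₂ (M-completes i j) e))

  rowSpanCompletion⇒solution : RowSpanCompletion A H → IsSolution A (Ker H)
  rowSpanCompletion⇒solution (M , M-completes , M-rowSpan) =
    M , (λ _ _ → false) , M-completes , (λ _ _ _ _ → refl) , M-kills-ker
    where
    M-kills-ker : ∀ x → Ker H x → ∀ i → (M · x) i ≡ false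
    M-kills-ker x x∈ker i = let (c , Mi≡) = M-rowSpan i in begin
      M i ∙ x                  ≡⟨ Σ₂-cong n (λ j → cong (_∧ x j) (Mi≡ j)) ⟩
      combination c H ∙ x      ≡⟨ combination-∙ c H x ⟩
      c ∙ (H · x)              ≡⟨ ∙-zeroʳ c x∈ker ⟩
      false                    ∎

lemma14 : ∀ {m n k} (A : PMatrix m n) (H : BMatrix k n) →
    IsSolution A (Ker H) ⇔ Σ (BMatrix m n) (λ M → IsCompletion A M × (∀ i → InRowSpan H (M i)))
lemma14 A H = mk⇔ (solution⇒rowSpanCompletion A H) (rowSpanCompletion⇒solution A H)
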